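{- Let $n$ be even and let $G$ be a directed graph on $[n]$ consisting of a collection of $n/2$ vertex-disjoint 2-cycles, described by a fixed-point-free involution $\pi$ of $[n]$, together with a self loop at every vertex, with all edges labeled by distinct non-commuting variables. Then any non-commutative algebraic branching program computing the Cayley permanent of $G$ has size at least $2^{\Omega({\sf cut}(G))}$.
   Context: Polynomials live in the free (non-commutative) algebra over an arbitrary field $\mathbb{K}$. A non-commutative algebraic branching program is a directed acyclic graph with distinguished nodes $s,t$, edges labeled by variables or field constants, computing the sum over all $s\leadsto t$ paths of the product of edge labels in path order; size is the number of nodes. The Cayley permanent of $G$ is $\sum_{\sigma\in S_n}x_{1,\sigma(1)}\cdots x_{n,\sigma(n)}$ (product in this order), where $x_{i,j}$ is the label of edge $(i,j)$ and $0$ if there is no such edge. For $1\le i\le n$, $C_i(\pi)$ is the set of transpositions $\{j,\pi(j)\}$ of $\pi$ with $\min(j,\pi(j))\le i\le\max(j,\pi(j))$, and ${\sf cut}(G)={\sf cut}(\pi)=\max_{1\le k\le n}|C_k(\pi)|$. -}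

module Defs where

open import Level using (Level; _⊔_; Setω) renaming (suc to lsuc)
open import Algebra.Bundles using (CommutativeRing)
open import Data.Nat as ℕ using (ℕ; zero; suc; _<_; _≤_)
open import Data.Fin as Fin using (Fin; toℕ)
open import Data.Fin.Properties using () renaming (_≟_ to _≟ᶠ_)
open import Data.Product using (Σ; _×_; _,_; ∃-syntax)
open import Data.Product.Properties using (≡-dec)
open import Data.List as List using (List; []; _∷_; map; foldr; allFin; concatMap; filter; length)
open import Data.Vec as Vec using (Vec; []; _∷_; toList)
open import Data.Maybe using (Maybe; just; nothing)
open import Relation.Nullary using (¬_; Dec; yes; no)
open import Relation.Nullary.Decidable using (⌊_⌋; _×-dec_; _⊎-dec_)
open import Relation.Binary.PropositionalEquality using (_≡_; _≢_)
open import Relation.Binary.Definitions using (DecidableEquality)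
import Data.List.Relation.Unary.Unique.DecPropositional as UniqueDec

record Field (c ℓ : Level) : Set (lsuc (c ⊔ ℓ)) where
  field
    commutativeRing : CommutativeRing c ℓ
  open CommutativeRing commutativeRing public
  field
    0≉1     : ¬ (0# ≈ 1#)
    inverse : ∀ x → ¬ (x ≈ 0#) → Σ Carrier λ y → (x * y) ≈ 1#

-- Non-commutative polynomials over a field K in variables X (decidable
-- equality), represented by their coefficient function on words
-- (monomials = lists of variables, multiplied in list order).

module NCPoly {c ℓ} (K : Field c ℓ) {X : Set} (_≟X_ : DecidableEquality X) where
  open Field K

  Poly : Set c
  Poly = List X → Carrier

  _≈P_ : Poly → Poly → Set ℓ
  f ≈P g = ∀ w → f w ≈ g w

  sumK : List Carrier → Carrier
  sumK = foldr _+_ 0#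

  constP : Carrier → Poly
  constP a []      = a
  constP a (_ ∷ _) = 0#

  0P 1P : Poly
  0P = constP 0#
  1P = constP 1#

  varP : X → Poly
  varP x (y ∷ []) with x ≟X y
  ... | yes _ = 1#
  ... | no  _ = 0#
  varP x _ = 0#

  _+P_ : Poly → Poly → Poly
  (f +P g) w = f w + g w

  splits : List X → List (List X × List X)
  splits []      = ([] , []) ∷ []
  splits (a ∷ w) = ([] , a ∷ w) ∷ map (λ { (u , v) → (a ∷ u , v) }) (splits w)

  _*P_ : Poly → Poly → Poly
  (f *P g) w = sumK (map (λ { (u , v) → f u * g v }) (splits w))

  ΣP : ∀ {A : Set} → List A → (A → Poly) → Poly
  ΣP xs f = foldr (λ a acc → f a +P acc) 0P xs

  ΠP : List Poly → Poly
  ΠP = foldr _*P_ 1P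

  -- Nodes are Fin size, numbered in a topological order (every DAG admits
  -- one), so an edge i → j can only exist if i < j.

  data Label : Set c where
    var   : X → Label
    const : Carrier → Label

  ⟦_⟧L : Label → Poly
  ⟦ var x ⟧L   = varP x
  ⟦ const a ⟧L = constP a

  record ABP : Set c where
    field
      size    : ℕ
      edge    : Fin size → Fin size → Maybe Label
      acyclic : ∀ i j → ¬ (toℕ i < toℕ j) → edge i j ≡ nothing
      s t     : Fin size

  module _ (A : ABP) where
    open ABP A

    edgeP : Maybe Label → Poly
    edgeP nothing  = 0P
    edgeP (just l) = ⟦ l ⟧L

    -- Since paths in the DAG have length
    -- < size, fuel = size gives exactly the sum over all v ⇝ t paths.
    fromNode : ℕ → Fin size → Poly
    fromNode zero    v = 0P
    fromNode (suc k) v =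
      (if⌊ v ≟ᶠ t ⌋) +P ΣP (allFin size) (λ j → edgeP (edge v j) *P fromNode k j)
      where
      if⌊_⌋ : ∀ {P : Set} → Dec P → Poly
      if⌊ yes _ ⌋ = 1P
      if⌊ no  _ ⌋ = 0P

    output : Poly
    output = fromNode size s

  Computes : ABP → Poly → Set ℓ
  Computes A f = output A ≈P f

record FPFInvolution (n : ℕ) : Set where
  field
    π        : Fin n → Fin n
    involut  : ∀ i → π (π i) ≡ i
    fpFree   : ∀ i → π i ≢ i

-- Edges of the graph G_π: the 2-cycles {i, π i} and a self loop at every
-- vertex.  The label of edge (i , j) is the variable (i , j).
Edge : ∀ {n} → (Fin n → Fin n) → Fin n → Fin n → Set
Edge π i j = (j ≡ i) Data.Sum.⊎ (j ≡ π i)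
  where import Data.Sum

edge? : ∀ {n} (π : Fin n → Fin n) i j → Dec (Edge π i j)
edge? π i j = (j ≟ᶠ i) ⊎-dec (j ≟ᶠ π i)

Var : ℕ → Set
Var n = Fin n × Fin n

_≟V_ : ∀ {n} → DecidableEquality (Var n)
_≟V_ = ≡-dec _≟ᶠ_ _≟ᶠ_

allVecs : ∀ n k → List (Vec (Fin n) k)
allVecs n zero    = [] ∷ []
allVecs n (suc k) = concatMap (λ i → map (i ∷_) (allVecs n k)) (allFin n)

permutations : ∀ n → List (Vec (Fin n) n)
permutations n = filter (λ v → unique? (toList v)) (allVecs n n)
  where open UniqueDec _≟ᶠ_

cayleyPerm : ∀ {c ℓ} (K : Field c ℓ) n (π : Fin n → Fin n) → NCPoly.Poly K (_≟V_ {n})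
cayleyPerm K n π = ΣP (permutations n) (λ σ → ΠP (List.map (λ i → x i (Vec.lookup σ i)) (allFin n)))
  where
  open NCPoly K (_≟V_ {n})
  x : Fin n → Fin n → Poly
  x i j with edge? π i j
  ... | yes _ = varP (i , j)
  ... | no  _ = 0P

-- cut(π).  C_k(π) is the set of transpositions {j, π j} with
-- min(j, π j) ≤ k ≤ max(j, π j); each transposition is counted once via
-- its smaller endpoint j (j < π j).
Ccard : ∀ {n} → (Fin n → Fin n) → Fin n → ℕ
Ccard {n} π k = length (filter (λ j → (j Fin.<? π j) ×-dec ((j Fin.≤? k) ×-dec (k Fin.≤? π j))) (allFin n))

cut : ∀ {n} → (Fin n → Fin n) → ℕ
cut {n} π = foldr ℕ._⊔_ 0 (map (Ccard π) (allFin n))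

-- Existence of two natural constants (the statement quantifies over all
-- field universe levels, so it lives in Setω).
record ∃₂ω (P : ℕ → ℕ → Setω) : Setω where
  constructor _,_,_
  field
    a k₀ : ℕ
    prop : P a k₀

abpSize : ∀ {c ℓ} {K : Field c ℓ} {X : Set} {d : DecidableEquality X} → NCPoly.ABP K d → ℕ
abpSize A = NCPoly.ABP.size A

module Submission where

-- Fix a position p and split every word of length n after its first p
-- letters into a prefix u and a suffix w.
--  * Upper bound (Factorisation): for an ABP with S nodes the coefficient
--    of u ++ w is Σ_st before(u)_st · after_st(w) over the S·(S+1) states
--    st = (node, remaining path budget), so the prefix/suffix coefficient
--    matrix factors through S·(S+1) dimensions.
--  * Lower bound (PermanentCoefficients, Crossings): let m be the number of
--    transpositions {j, π j} crossing p (j < p ≤ π j).  For each of the 2^m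
--    sets D of them, swap_D exchanges exactly the pairs in D; its prefix
--    word u_D and suffix word w_E of swap_E combine to the word of a map
--    glue D E, which is a permutation when D = E (coefficient 1) and sends
--    j and π j to the same vertex when D, E differ at j (coefficient 0).
-- The rank lemma (RankBound) turns these into 2^m ≤ S·(S+1)
-- (PositionBound).  Finally every C_k(π) is covered by the crossing sets
-- at positions k and k+1, so 2^cut ≤ (S·(S+1))² ≤ S⁶ once cut ≥ 3.

open import Algebra.Bundles using (CommutativeRing)
open import Defs hiding (_,_,_)
open import Data.Nat as ℕ using (ℕ; zero; suc; _<_; _≤_; z≤n; s≤s; _^_)
import Data.Nat.Properties as ℕP
open import Data.Nat.Divisibility using (_∣_)
open import Data.Fin as Fin using (Fin; toℕ)
open import Data.Fin.Properties using () renaming (_≟_ to _≟ᶠ_)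
open import Data.Bool using (Bool; true; false; if_then_else_; _∨_)
import Data.Bool.Properties as BoolP
open import Data.List as List using (List; []; _∷_; map; foldr; length; _++_)
import Data.List.Properties as ListP
open import Data.List.Relation.Unary.All as All using (All; []; _∷_)
import Data.List.Relation.Unary.All.Properties as AllP
open import Data.List.Relation.Unary.Any using (here; there)
open import Data.List.Relation.Unary.AllPairs as AllPairs using (AllPairs; []; _∷_)
import Data.List.Relation.Unary.AllPairs.Properties as AllPairsP
open import Data.List.Membership.Propositional using (_∈_)
open import Data.List.Membership.Propositional.Properties using (∈-allFin; ∈-upTo⁺; ∈-filter⁻; ∈-tabulate⁺)
open import Data.List.Relation.Unary.Unique.Propositional using (Unique)
import Data.List.Relation.Unary.Unique.Propositional.Properties as UniqueP
import Data.List.Relation.Unary.Unique.DecPropositional as UniqueDec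
open import Data.Vec as Vec using (Vec; []; _∷_)
import Data.Vec.Properties as VecP
open import Data.Maybe using (Maybe; just; nothing)
open import Data.Product using (Σ; _×_; _,_; proj₁; proj₂; ∃)
open import Data.Sum using (_⊎_; inj₁; inj₂)
open import Data.Empty using (⊥; ⊥-elim)
open import Relation.Nullary using (¬_; Dec; yes; no; does)
open import Relation.Nullary.Decidable using (_×-dec_)
open import Relation.Unary using (Decidable)
open import Relation.Binary.Definitions using (DecidableEquality)
open import Relation.Binary.PropositionalEquality as Eq using (_≡_; refl)

module ListSums {c ℓ} (R : CommutativeRing c ℓ) where
  open CommutativeRing R renaming (refl to ≈-refl; sym to ≈-sym; trans to ≈-trans)
  open import Relation.Binary.Reasoning.Setoid setoid
  open import Algebra.Properties.Ring ring using (-0#≈0#; -‿+-comm)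

  Σ' : ∀ {A : Set} → List A → (A → Carrier) → Carrier
  Σ' xs f = foldr _+_ 0# (map f xs)

  ind : ∀ {p} {P : Set p} → Dec P → Carrier
  ind (yes _) = 1#
  ind (no _)  = 0#

  ind-yes : ∀ {p} {P : Set p} → P → (d : Dec P) → ind d ≈ 1#
  ind-yes _ (yes _) = ≈-refl
  ind-yes p (no ¬p) = ⊥-elim (¬p p)

  ind-no : ∀ {p} {P : Set p} → ¬ P → (d : Dec P) → ind d ≈ 0#
  ind-no ¬p (yes p) = ⊥-elim (¬p p)
  ind-no _  (no _)  = ≈-refl

  Σ-cong : ∀ {A : Set} (xs : List A) {f g : A → Carrier} → (∀ a → f a ≈ g a) → Σ' xs f ≈ Σ' xs g
  Σ-cong []       f≈g = ≈-refl
  Σ-cong (x ∷ xs) f≈g = +-cong (f≈g x) (Σ-cong xs f≈g)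

  Σ-zeroAll : ∀ {A : Set} (xs : List A) {f : A → Carrier} → All (λ a → f a ≈ 0#) xs → Σ' xs f ≈ 0#
  Σ-zeroAll []       []       = ≈-refl
  Σ-zeroAll (x ∷ xs) (p ∷ ps) = ≈-trans (+-cong p (Σ-zeroAll xs ps)) (+-identityˡ 0#)

  Σ-zero : ∀ {A : Set} (xs : List A) {f : A → Carrier} → (∀ a → f a ≈ 0#) → Σ' xs f ≈ 0#
  Σ-zero xs f≈0 = Σ-zeroAll xs (All.tabulate (λ {a} _ → f≈0 a))

  Σ-+ : ∀ {A : Set} (xs : List A) (f g : A → Carrier) → Σ' xs (λ a → f a + g a) ≈ Σ' xs f + Σ' xs g
  Σ-+ []       f g = ≈-sym (+-identityˡ 0#)
  Σ-+ (x ∷ xs) f g = begin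
    (f x + g x) + Σ' xs (λ a → f a + g a) ≈⟨ +-congˡ (Σ-+ xs f g) ⟩
    (f x + g x) + (Σ' xs f + Σ' xs g)     ≈⟨ +-assoc _ _ _ ⟩
    f x + (g x + (Σ' xs f + Σ' xs g))     ≈⟨ +-congˡ (≈-sym (+-assoc _ _ _)) ⟩
    f x + ((g x + Σ' xs f) + Σ' xs g)     ≈⟨ +-congˡ (+-congʳ (+-comm _ _)) ⟩
    f x + ((Σ' xs f + g x) + Σ' xs g)     ≈⟨ +-congˡ (+-assoc _ _ _) ⟩
    f x + (Σ' xs f + (g x + Σ' xs g))     ≈⟨ ≈-sym (+-assoc _ _ _) ⟩
    (f x + Σ' xs f) + (g x + Σ' xs g)     ∎

  Σ-neg : ∀ {A : Set} (xs : List A) (f : A → Carrier) → Σ' xs (λ a → - f a) ≈ - Σ' xs f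
  Σ-neg []       f = ≈-sym -0#≈0#
  Σ-neg (x ∷ xs) f = ≈-trans (+-congˡ (Σ-neg xs f)) (-‿+-comm _ _)

  Σ-*ˡ : ∀ {A : Set} (xs : List A) (a : Carrier) (f : A → Carrier) → a * Σ' xs f ≈ Σ' xs (λ x → a * f x)
  Σ-*ˡ []       a f = zeroʳ a
  Σ-*ˡ (x ∷ xs) a f = ≈-trans (distribˡ a _ _) (+-congˡ (Σ-*ˡ xs a f))

  Σ-*ʳ : ∀ {A : Set} (xs : List A) (a : Carrier) (f : A → Carrier) → Σ' xs f * a ≈ Σ' xs (λ x → f x * a)
  Σ-*ʳ []       a f = zeroˡ a
  Σ-*ʳ (x ∷ xs) a f = ≈-trans (distribʳ a _ _) (+-congˡ (Σ-*ʳ xs a f))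

  Σ-swap : ∀ {A B : Set} (xs : List A) (ys : List B) (f : A → B → Carrier) →
           Σ' xs (λ a → Σ' ys (f a)) ≈ Σ' ys (λ b → Σ' xs (λ a → f a b))
  Σ-swap []       ys f = ≈-sym (Σ-zero ys (λ _ → ≈-refl))
  Σ-swap (x ∷ xs) ys f = ≈-trans (+-congˡ (Σ-swap xs ys f)) (≈-sym (Σ-+ ys _ _))

  Σ-++ : ∀ {A : Set} (xs ys : List A) (f : A → Carrier) → Σ' (xs ++ ys) f ≈ Σ' xs f + Σ' ys f
  Σ-++ []       ys f = ≈-sym (+-identityˡ _)
  Σ-++ (x ∷ xs) ys f = ≈-trans (+-congˡ (Σ-++ xs ys f)) (≈-sym (+-assoc _ _ _))

  Σ-map : ∀ {A B : Set} (xs : List A) (g : A → B) (f : B → Carrier) → Σ' (map g xs) f ≈ Σ' xs (λ a → f (g a))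
  Σ-map []       g f = ≈-refl
  Σ-map (x ∷ xs) g f = +-congˡ (Σ-map xs g f)

  Σ-concatMap : ∀ {A B : Set} (xs : List A) (g : A → List B) (f : B → Carrier) →
                Σ' (List.concatMap g xs) f ≈ Σ' xs (λ a → Σ' (g a) f)
  Σ-concatMap []       g f = ≈-refl
  Σ-concatMap (x ∷ xs) g f = ≈-trans (Σ-++ (g x) _ f) (+-congˡ (Σ-concatMap xs g f))

  Σ-filter : ∀ {A : Set} {P : A → Set} (P? : Decidable P) (xs : List A) (f : A → Carrier) →
             Σ' (List.filter P? xs) f ≈ Σ' xs (λ x → ind (P? x) * f x)
  Σ-filter P? []       f = ≈-refl
  Σ-filter P? (x ∷ xs) f with P? x
  ... | yes _ = +-cong (≈-sym (*-identityˡ _)) (Σ-filter P? xs f)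
  ... | no  _ = ≈-trans (Σ-filter P? xs f) (≈-sym (≈-trans (+-congʳ (zeroˡ _)) (+-identityˡ _)))

  Σ-δ : ∀ {A : Set} (xs : List A) {x : A} (f : A → Carrier) → Unique xs → x ∈ xs →
        (∀ a → ¬ a ≡ x → f a ≈ 0#) → Σ' xs f ≈ f x
  Σ-δ (a ∷ xs) f (a∉xs ∷ u) (here refl) f≈0 =
    ≈-trans (+-congˡ (Σ-zeroAll xs (All.map (λ {b} a≢b → f≈0 b (λ b≡a → a≢b (Eq.sym b≡a))) a∉xs))) (+-identityʳ _)
  Σ-δ (a ∷ xs) f (a∉xs ∷ u) (there x∈xs) f≈0 =
    ≈-trans (+-cong (f≈0 a (All.lookup a∉xs x∈xs)) (Σ-δ xs f u x∈xs f≈0)) (+-identityˡ _)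

  remove : ∀ {A : Set} {y : A} (ys : List A) → y ∈ ys → List A
  remove (_ ∷ ys) (here _)  = ys
  remove (x ∷ ys) (there p) = x ∷ remove ys p

  length-remove : ∀ {A : Set} {y : A} (ys : List A) (p : y ∈ ys) → length ys ≡ suc (length (remove ys p))
  length-remove (_ ∷ ys) (here _)  = refl
  length-remove (x ∷ ys) (there p) = Eq.cong suc (length-remove ys p)

  Σ-remove : ∀ {A : Set} {y : A} (ys : List A) (p : y ∈ ys) (f : A → Carrier) → Σ' ys f ≈ f y + Σ' (remove ys p) f
  Σ-remove (_ ∷ ys) (here refl) f = ≈-refl
  Σ-remove {y = y} (x ∷ ys) (there p) f = begin
    f x + Σ' ys f                     ≈⟨ +-congˡ (Σ-remove ys p f) ⟩
    f x + (f y + Σ' (remove ys p) f)  ≈⟨ ≈-sym (+-assoc _ _ _) ⟩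
    (f x + f y) + Σ' (remove ys p) f  ≈⟨ +-congʳ (+-comm _ _) ⟩
    (f y + f x) + Σ' (remove ys p) f  ≈⟨ +-assoc _ _ _ ⟩
    f y + (f x + Σ' (remove ys p) f)  ∎

-- View L : A → B → K and R : B → A → K as
-- matrices; if their product, restricted to a list xs of pairwise
-- D-related indices, is the identity, then xs has at most |ys| entries:
-- an identity matrix of size |xs| cannot factor through |ys| dimensions.
module RankBound {c ℓ} (K : Field c ℓ) where
  open Field K renaming (refl to ≈-refl; sym to ≈-sym; trans to ≈-trans)
  open import Relation.Binary.Reasoning.Setoid setoid
  open import Algebra.Properties.Ring ring using (-‿distribˡ-*; -0#≈0#)
  open ListSums commutativeRing

  Product : ∀ {A B : Set} → List B → (A → B → Carrier) → (B → A → Carrier) → A → A → Carrier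
  Product ys L R x z = Σ' ys (λ y → L x y * R y z)

  record IdentityOn {A B : Set} (D : A → A → Set) (xs : List A) (ys : List B)
                    (L : A → B → Carrier) (R : B → A → Carrier) : Set ℓ where
    field
      diagonal    : ∀ {x} → x ∈ xs → Product ys L R x x ≈ 1#
      offDiagonal : ∀ {x z} → x ∈ xs → z ∈ xs → D x z →
                    (Product ys L R x z ≈ 0#) × (Product ys L R z x ≈ 0#)

  -- a row that is not identically zero has a nonzero entry (only doubly
  -- negated, since field equality need not be decidable)
  nonzero-entry : ∀ {B : Set} (ys : List B) (g : B → Carrier) →
                  ¬ All (λ y → g y ≈ 0#) ys → ¬ ¬ (∃ λ y → y ∈ ys × ¬ g y ≈ 0#)
  nonzero-entry []       g notAll k = notAll []
  nonzero-entry (y ∷ ys) g notAll k =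
    k (y , here refl , λ gy≈0 →
      nonzero-entry ys g (λ rest → notAll (gy≈0 ∷ rest)) (λ { (y' , m , nz) → k (y' , there m , nz) }))

  -- one Gaussian elimination step: subtracting multiples of row x₀ clears
  -- the pivot column y₀, and rows orthogonal to x₀ keep their products
  module Eliminate {A B : Set} (ys : List B) (L : A → B → Carrier) (R : B → A → Carrier)
                   (x₀ : A) {y₀ : B} (y₀∈ys : y₀ ∈ ys) (c : Carrier) (inv : L x₀ y₀ * c ≈ 1#) where

    ys' : List B
    ys' = remove ys y₀∈ys

    L' : A → B → Carrier
    L' x y = L x y + - (L x y₀ * c * L x₀ y)

    pivot-cleared : ∀ x → L' x y₀ ≈ 0#
    pivot-cleared x = begin
      L x y₀ + - (L x y₀ * c * L x₀ y₀)   ≈⟨ +-congˡ (-‿cong (*-assoc _ _ _)) ⟩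
      L x y₀ + - (L x y₀ * (c * L x₀ y₀)) ≈⟨ +-congˡ (-‿cong (*-congˡ (≈-trans (*-comm _ _) inv))) ⟩
      L x y₀ + - (L x y₀ * 1#)            ≈⟨ +-congˡ (-‿cong (*-identityʳ _)) ⟩
      L x y₀ + - L x y₀                   ≈⟨ -‿inverseʳ _ ⟩
      0#                                  ∎

    Product-L' : ∀ x z → Product ys' L' R x z ≈ Product ys L R x z + - (L x y₀ * c * Product ys L R x₀ z)
    Product-L' x z = begin
      Product ys' L' R x z                              ≈⟨ ≈-sym (+-identityˡ _) ⟩
      0# + Product ys' L' R x z                         ≈⟨ +-congʳ (≈-sym (≈-trans (*-congʳ (pivot-cleared x)) (zeroˡ _))) ⟩
      L' x y₀ * R y₀ z + Product ys' L' R x z           ≈⟨ ≈-sym (Σ-remove ys y₀∈ys (λ y → L' x y * R y z)) ⟩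
      Product ys L' R x z                               ≈⟨ Σ-cong ys distribute ⟩
      Σ' ys (λ y → L x y * R y z + - (a * (L x₀ y * R y z)))
        ≈⟨ Σ-+ ys _ _ ⟩
      Product ys L R x z + Σ' ys (λ y → - (a * (L x₀ y * R y z)))
        ≈⟨ +-congˡ (≈-trans (Σ-neg ys _) (-‿cong (≈-sym (Σ-*ˡ ys _ _)))) ⟩
      Product ys L R x z + - (a * Product ys L R x₀ z)  ∎
      where
      a = L x y₀ * c
      distribute : ∀ y → L' x y * R y z ≈ L x y * R y z + - (a * (L x₀ y * R y z))
      distribute y = ≈-trans (distribʳ _ _ _) (+-congˡ (≈-trans (≈-sym (-‿distribˡ-* _ _)) (-‿cong (*-assoc _ _ _))))

    Product-unchanged : ∀ x z → Product ys L R x₀ z ≈ 0# → Product ys' L' R x z ≈ Product ys L R x z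
    Product-unchanged x z orth = ≈-trans (Product-L' x z)
      (≈-trans (+-congˡ (≈-trans (-‿cong (≈-trans (*-congˡ orth) (zeroʳ _))) -0#≈0#)) (+-identityʳ _))

  -- induction on xs: each step removes one row and one column
  too-few-columns : ∀ {A B : Set} {D : A → A → Set} (xs : List A) (ys : List B) L R →
                    AllPairs D xs → IdentityOn D xs ys L R → length ys < length xs → ⊥
  too-few-columns (x₀ ∷ xs) ys L R (x₀~xs ∷ pairs) id len =
    nonzero-entry ys (L x₀) row-nonzero pivot
    where
    open IdentityOn id

    row-nonzero : ¬ All (λ y → L x₀ y ≈ 0#) ys
    row-nonzero zeros = 0≉1 (≈-trans (≈-sym (Σ-zeroAll ys (All.map (λ e → ≈-trans (*-congʳ e) (zeroˡ _)) zeros)))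
                                     (diagonal (here refl)))

    orthogonal : ∀ {z} → z ∈ xs → Product ys L R x₀ z ≈ 0#
    orthogonal z∈xs = proj₁ (offDiagonal (here refl) (there z∈xs) (All.lookup x₀~xs z∈xs))

    pivot : (∃ λ y → y ∈ ys × ¬ L x₀ y ≈ 0#) → ⊥
    pivot (y₀ , y₀∈ys , nz) with inverse (L x₀ y₀) nz
    ... | c , inv = too-few-columns xs ys' L' R pairs id' len'
      where
      open Eliminate ys L R x₀ y₀∈ys c inv
      len' : length ys' < length xs
      len' = ℕP.≤-pred (Eq.subst (λ m → suc m ≤ suc (length xs)) (length-remove ys y₀∈ys) len)
      id' : IdentityOn _ xs ys' L' R
      id' = record
        { diagonal    = λ {x} x∈xs → ≈-trans (Product-unchanged x x (orthogonal x∈xs)) (diagonal (there x∈xs))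
        ; offDiagonal = λ {x} {z} x∈xs z∈xs d →
            ≈-trans (Product-unchanged x z (orthogonal z∈xs)) (proj₁ (offDiagonal (there x∈xs) (there z∈xs) d))
          , ≈-trans (Product-unchanged z x (orthogonal x∈xs)) (proj₂ (offDiagonal (there x∈xs) (there z∈xs) d))
        }

  rank-bound : ∀ {A B : Set} {D : A → A → Set} (xs : List A) (ys : List B) L R →
               AllPairs D xs → IdentityOn D xs ys L R → length xs ≤ length ys
  rank-bound xs ys L R pairs id = ℕP.≮⇒≥ (too-few-columns xs ys L R pairs id)

length-concatMap : ∀ {A B : Set} (xs : List A) (g : A → List B) m → (∀ x → length (g x) ≡ m) →
                   length (List.concatMap g xs) ≡ length xs ℕ.* m
length-concatMap []       g m len = refl
length-concatMap (x ∷ xs) g m len =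
  Eq.trans (ListP.length-++ (g x)) (Eq.cong₂ ℕ._+_ (len x) (length-concatMap xs g m len))

module Coefficients {c ℓ} (K : Field c ℓ) {X : Set} (_≟X_ : DecidableEquality X) where
  open Field K renaming (refl to ≈-refl; sym to ≈-sym; trans to ≈-trans)
  open import Relation.Binary.Reasoning.Setoid setoid
  open NCPoly K _≟X_
  open ListSums commutativeRing

  Σ-splits : ∀ (H : List X × List X → Carrier) w → (∀ b u v → H (b ∷ u , v) ≈ 0#) →
             sumK (map H (splits w)) ≈ H ([] , w)
  Σ-splits H []      H≈0 = +-identityʳ _
  Σ-splits H (a ∷ w) H≈0 =
    ≈-trans (+-congˡ (≈-trans (Σ-map (splits w) _ H) (Σ-zero (splits w) (λ { (u , v) → H≈0 a u v })))) (+-identityʳ _)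

  const-*P : ∀ a g w → (constP a *P g) w ≈ a * g w
  const-*P a g w = Σ-splits _ w (λ _ _ _ → zeroˡ _)

  var-*P : ∀ x g z w → (varP x *P g) (z ∷ w) ≈ ind (x ≟X z) * g w
  var-*P x g z w = begin
    (varP x *P g) (z ∷ w)                  ≈⟨ +-congˡ (≈-trans (Σ-map (splits w) _ _) (Σ-splits _ w (λ _ _ _ → zeroˡ _))) ⟩
    0# * g (z ∷ w) + varP x (z ∷ []) * g w ≈⟨ +-cong (zeroˡ _) (*-congʳ var-coeff) ⟩
    0# + ind (x ≟X z) * g w                ≈⟨ +-identityˡ _ ⟩
    ind (x ≟X z) * g w                     ∎
    where
    var-coeff : varP x (z ∷ []) ≈ ind (x ≟X z)
    var-coeff with x ≟X z
    ... | yes _ = ≈-refl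
    ... | no  _ = ≈-refl

  0P-coeff : ∀ w → 0P w ≈ 0#
  0P-coeff []      = ≈-refl
  0P-coeff (_ ∷ _) = ≈-refl

  ΣP-coeff : ∀ {A : Set} (xs : List A) (f : A → Poly) w → ΣP xs f w ≈ Σ' xs (λ a → f a w)
  ΣP-coeff []       f w = 0P-coeff w
  ΣP-coeff (x ∷ xs) f w = +-congˡ (ΣP-coeff xs f w)

-- The upper bound: every coefficient f(u ++ w) of the polynomial computed
-- by an ABP with S nodes is a sum, over the S·(S+1) states (j, k) = "at
-- node j with path budget k", of a number depending only on u times the
-- coefficient of w in fromNode k j.
module Factorisation {c ℓ} (K : Field c ℓ) {X : Set} (_≟X_ : DecidableEquality X)
                     (A : NCPoly.ABP K _≟X_) where
  open Field K renaming (refl to ≈-refl; sym to ≈-sym; trans to ≈-trans)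
  open import Relation.Binary.Reasoning.Setoid setoid
  open NCPoly K _≟X_
  open ListSums commutativeRing
  open Coefficients K _≟X_
  open ABP A

  -- (node, remaining path budget); from the initial budget S only budgets 0 … S occur
  State : Set
  State = Fin size × ℕ

  states : List State
  states = List.concatMap (λ j → map (j ,_) (List.upTo (suc size))) (List.allFin size)

  length-states : length states ≡ size ℕ.* suc size
  length-states = Eq.trans
    (length-concatMap (List.allFin size) _ (suc size)
      (λ j → Eq.trans (ListP.length-map (j ,_) (List.upTo (suc size))) (ListP.length-upTo (suc size))))
    (Eq.cong (ℕ._* suc size) (ListP.length-tabulate {n = size} (λ i → i)))

  after : State → List X → Carrier
  after (j , k) w = fromNode A k j w

  -- the contribution of one edge label to reading the letter y: a constant
  -- a keeps the word (weight a · r₁), a variable z consumes y (weight r₂)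
  edgeWeight : Maybe Label → Carrier → Carrier → X → Carrier
  edgeWeight nothing          _  _  _ = 0#
  edgeWeight (just (const a)) r₁ _  _ = a * r₁
  edgeWeight (just (var z))   _  r₂ y = ind (z ≟X y) * r₂

  -- before k v u st: total weight of the paths from v with budget k that
  -- read the prefix u and stop in the state st
  before : ℕ → Fin size → List X → State → Carrier
  before k       v []      (j , k') = ind (j ≟ᶠ v) * ind (k' ℕ.≟ k)
  before zero    v (y ∷ u) st       = 0#
  before (suc k) v (y ∷ u) st       =
    Σ' (List.allFin size) (λ j → edgeWeight (edge v j) (before k j (y ∷ u) st) (before k j u st) y)

  through : ℕ → Fin size → List X → List X → Carrier
  through k v u w = Σ' states (λ st → before k v u st * after st w)

  -- with an empty prefix the sum picks out the single state (v, k)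
  factor-[] : ∀ k → k ≤ size → ∀ v w → fromNode A k v w ≈ through k v [] w
  factor-[] k k≤S v w = ≈-sym (begin
    through k v [] w
      ≈⟨ Σ-concatMap (List.allFin size) _ _ ⟩
    Σ' (List.allFin size) (λ j → Σ' (map (j ,_) (List.upTo (suc size))) (λ st → before k v [] st * after st w))
      ≈⟨ Σ-cong (List.allFin size) (λ j → Σ-map (List.upTo (suc size)) _ _) ⟩
    Σ' (List.allFin size) (λ j → Σ' (List.upTo (suc size)) (λ k' → before k v [] (j , k') * after (j , k') w))
      ≈⟨ Σ-δ (List.allFin size) _ (UniqueP.allFin⁺ size) (∈-allFin v) other-node ⟩
    Σ' (List.upTo (suc size)) (λ k' → before k v [] (v , k') * after (v , k') w)
      ≈⟨ Σ-δ (List.upTo (suc size)) _ (UniqueP.upTo⁺ (suc size)) (∈-upTo⁺ (s≤s k≤S)) other-budget ⟩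
    before k v [] (v , k) * after (v , k) w
      ≈⟨ ≈-trans (*-congʳ (≈-trans (*-cong (ind-yes refl (v ≟ᶠ v)) (ind-yes refl (k ℕ.≟ k))) (*-identityˡ _))) (*-identityˡ _) ⟩
    fromNode A k v w ∎)
    where
    other-node : ∀ j → ¬ j ≡ v → Σ' (List.upTo (suc size)) (λ k' → before k v [] (j , k') * after (j , k') w) ≈ 0#
    other-node j j≢v = Σ-zero (List.upTo (suc size)) (λ k' → ≈-trans (*-congʳ (≈-trans (*-congʳ (ind-no j≢v (j ≟ᶠ v))) (zeroˡ _))) (zeroˡ _))
    other-budget : ∀ k' → ¬ k' ≡ k → before k v [] (v , k') * after (v , k') w ≈ 0#
    other-budget k' k'≢k = ≈-trans (*-congʳ (≈-trans (*-congˡ (ind-no k'≢k (k' ℕ.≟ k))) (zeroʳ _))) (zeroˡ _)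

  -- on a nonempty word, the "v is the sink" term of fromNode contributes 0
  fromNode-∷ : ∀ k v y w → fromNode A (suc k) v (y ∷ w) ≈ ΣP (List.allFin size) (λ j → edgeP A (edge v j) *P fromNode A k j) (y ∷ w)
  fromNode-∷ k v y w with v ≟ᶠ t
  ... | yes _ = +-identityˡ _
  ... | no  _ = +-identityˡ _

  mutual
    factor : ∀ k → k ≤ size → ∀ v u w → fromNode A k v (u ++ w) ≈ through k v u w
    factor k       k≤S v []      w = factor-[] k k≤S v w
    factor zero    k≤S v (y ∷ u) w = ≈-sym (Σ-zero states (λ _ → zeroˡ _))
    factor (suc k) k≤S v (y ∷ u) w = begin
      fromNode A (suc k) v (y ∷ u ++ w)
        ≈⟨ ≈-trans (fromNode-∷ k v y (u ++ w)) (ΣP-coeff (List.allFin size) (λ j → edgeP A (edge v j) *P fromNode A k j) (y ∷ u ++ w)) ⟩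
      Σ' (List.allFin size) (λ j → (edgeP A (edge v j) *P fromNode A k j) (y ∷ u ++ w))
        ≈⟨ Σ-cong (List.allFin size) (λ j → factor-edge k (ℕP.≤-trans (ℕP.n≤1+n k) k≤S) (edge v j) j y u w) ⟩
      Σ' (List.allFin size) (λ j → Σ' states (λ st → edgeWeight (edge v j) (before k j (y ∷ u) st) (before k j u st) y * after st w))
        ≈⟨ Σ-swap (List.allFin size) states _ ⟩
      Σ' states (λ st → Σ' (List.allFin size) (λ j → edgeWeight (edge v j) (before k j (y ∷ u) st) (before k j u st) y * after st w))
        ≈⟨ Σ-cong states (λ st → ≈-sym (Σ-*ʳ (List.allFin size) _ _)) ⟩
      through (suc k) v (y ∷ u) w ∎

    factor-edge : ∀ k → k ≤ size → (e : Maybe Label) → ∀ j y u w →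
                  (edgeP A e *P fromNode A k j) (y ∷ u ++ w) ≈
                  Σ' states (λ st → edgeWeight e (before k j (y ∷ u) st) (before k j u st) y * after st w)
    factor-edge k k≤S nothing j y u w =
      ≈-trans (const-*P 0# (fromNode A k j) (y ∷ u ++ w)) (≈-trans (zeroˡ _) (≈-sym (Σ-zero states (λ _ → zeroˡ _))))
    factor-edge k k≤S (just (const a)) j y u w = begin
      (constP a *P fromNode A k j) (y ∷ u ++ w)            ≈⟨ const-*P a (fromNode A k j) (y ∷ u ++ w) ⟩
      a * fromNode A k j (y ∷ u ++ w)                      ≈⟨ *-congˡ (factor k k≤S j (y ∷ u) w) ⟩
      a * through k j (y ∷ u) w                            ≈⟨ Σ-*ˡ states _ _ ⟩
      Σ' states (λ st → a * (before k j (y ∷ u) st * after st w)) ≈⟨ Σ-cong states (λ _ → ≈-sym (*-assoc _ _ _)) ⟩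
      Σ' states (λ st → a * before k j (y ∷ u) st * after st w)   ∎
    factor-edge k k≤S (just (var z)) j y u w = begin
      (varP z *P fromNode A k j) (y ∷ u ++ w)              ≈⟨ var-*P z (fromNode A k j) y (u ++ w) ⟩
      ind (z ≟X y) * fromNode A k j (u ++ w)               ≈⟨ *-congˡ (factor k k≤S j u w) ⟩
      ind (z ≟X y) * through k j u w                       ≈⟨ Σ-*ˡ states _ _ ⟩
      Σ' states (λ st → ind (z ≟X y) * (before k j u st * after st w)) ≈⟨ Σ-cong states (λ _ → ≈-sym (*-assoc _ _ _)) ⟩
      Σ' states (λ st → ind (z ≟X y) * before k j u st * after st w)   ∎

  output-factor : ∀ u w → output A (u ++ w) ≈ through size s u w
  output-factor = factor size ℕP.≤-refl s

-- the permanent tests injectivity on vectors, whose list form is a table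
toList-tabulate : ∀ {A : Set} {n} (f : Fin n → A) → Vec.toList (Vec.tabulate f) ≡ List.tabulate f
toList-tabulate {n = zero}  f = refl
toList-tabulate {n = suc n} f = Eq.cong (f Fin.zero ∷_) (toList-tabulate (λ i → f (Fin.suc i)))

unique-tabulate-injective : ∀ {A : Set} {n} (f : Fin n → A) → Unique (List.tabulate f) → ∀ a b → f a ≡ f b → a ≡ b
unique-tabulate-injective f (f0∉ ∷ u) Fin.zero    Fin.zero    _ = refl
unique-tabulate-injective f (f0∉ ∷ u) Fin.zero    (Fin.suc b) e = ⊥-elim (All.lookup f0∉ (∈-tabulate⁺ b) e)
unique-tabulate-injective f (f0∉ ∷ u) (Fin.suc a) Fin.zero    e = ⊥-elim (All.lookup f0∉ (∈-tabulate⁺ a) (Eq.sym e))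
unique-tabulate-injective f (f0∉ ∷ u) (Fin.suc a) (Fin.suc b) e =
  Eq.cong Fin.suc (unique-tabulate-injective (λ i → f (Fin.suc i)) u a b e)

word : ∀ {n} → (Fin n → Fin n) → List (Fin n) → List (Var n)
word τ is = map (λ i → (i , τ i)) is

module PermanentCoefficients {c ℓ} (K : Field c ℓ) (n : ℕ) (π : Fin n → Fin n) where
  open Field K renaming (refl to ≈-refl; sym to ≈-sym; trans to ≈-trans)
  open import Relation.Binary.Reasoning.Setoid setoid
  open NCPoly K (_≟V_ {n})
  open ListSums commutativeRing
  open Coefficients K (_≟V_ {n})
  open UniqueDec (_≟ᶠ_ {n}) using (unique?)

  -- cayleyPerm is Σ_σ Π_i x_{i,σ(i)}, with x defined locally in Defs;
  -- unification against its definition names the matrix entries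
  permanent-shape : Σ (Vec (Fin n) n → Fin n → Poly) λ row →
                    cayleyPerm K n π ≡ ΣP (permutations n) (λ σ → ΠP (map (row σ) (List.allFin n)))
  permanent-shape = _ , refl

  entry : Vec (Fin n) n → Fin n → Poly
  entry = proj₁ permanent-shape

  entry-*P-match : ∀ σ i j g w → Vec.lookup σ i ≡ j → Edge π i j → (entry σ i *P g) ((i , j) ∷ w) ≈ g w
  entry-*P-match σ i _ g w refl e with edge? π i (Vec.lookup σ i)
  ... | yes _ = ≈-trans (var-*P x g x w) (≈-trans (*-congʳ (ind-yes refl (x ≟V x))) (*-identityˡ _))
    where x = (i , Vec.lookup σ i)
  ... | no ¬e = ⊥-elim (¬e e)

  entry-*P-mismatch : ∀ σ i j g w → ¬ Vec.lookup σ i ≡ j → (entry σ i *P g) ((i , j) ∷ w) ≈ 0#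
  entry-*P-mismatch σ i j g w σi≢j with edge? π i (Vec.lookup σ i)
  ... | yes _ = ≈-trans (var-*P (i , Vec.lookup σ i) g (i , j) w)
                  (≈-trans (*-congʳ (ind-no (λ eq → σi≢j (Eq.cong proj₂ eq)) ((i , Vec.lookup σ i) ≟V (i , j)))) (zeroˡ _))
  ... | no  _ = ≈-trans (const-*P 0# g ((i , j) ∷ w)) (zeroˡ _)

  entry-*P-zero : ∀ σ i g z w → g w ≈ 0# → (entry σ i *P g) (z ∷ w) ≈ 0#
  entry-*P-zero σ i g z w gw≈0 with edge? π i (Vec.lookup σ i)
  ... | yes _ = ≈-trans (var-*P (i , Vec.lookup σ i) g z w) (≈-trans (*-congˡ gw≈0) (zeroʳ _))
  ... | no  _ = ≈-trans (const-*P 0# g (z ∷ w)) (zeroˡ _)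

  monomial-match : ∀ σ τ is → All (λ i → Vec.lookup σ i ≡ τ i) is → All (λ i → Edge π i (τ i)) is →
                   ΠP (map (entry σ) is) (word τ is) ≈ 1#
  monomial-match σ τ []       []           []       = ≈-refl
  monomial-match σ τ (i ∷ is) (eq ∷ eqs) (e ∷ es) =
    ≈-trans (entry-*P-match σ i (τ i) (ΠP (map (entry σ) is)) (word τ is) eq e) (monomial-match σ τ is eqs es)

  monomial-mismatch : ∀ σ τ is → ¬ All (λ i → Vec.lookup σ i ≡ τ i) is → ΠP (map (entry σ) is) (word τ is) ≈ 0#
  monomial-mismatch σ τ []       ¬all = ⊥-elim (¬all [])
  monomial-mismatch σ τ (i ∷ is) ¬all with Vec.lookup σ i ≟ᶠ τ i
  ... | yes eq  = entry-*P-zero σ i (ΠP (map (entry σ) is)) (i , τ i) (word τ is)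
                    (monomial-mismatch σ τ is (λ eqs → ¬all (eq ∷ eqs)))
  ... | no  neq = entry-*P-mismatch σ i (τ i) (ΠP (map (entry σ) is)) (word τ is) neq

  Σ-allVecs-δ : ∀ k (h : Vec (Fin n) k → Carrier) (t : Vec (Fin n) k) → (∀ σ → ¬ σ ≡ t → h σ ≈ 0#) →
                Σ' (allVecs n k) h ≈ h t
  Σ-allVecs-δ zero    h []       h≈0 = +-identityʳ _
  Σ-allVecs-δ (suc k) h (t₀ ∷ t) h≈0 = begin
    Σ' (List.concatMap (λ i → map (i ∷_) (allVecs n k)) (List.allFin n)) h
      ≈⟨ Σ-concatMap (List.allFin n) _ h ⟩
    Σ' (List.allFin n) (λ i → Σ' (map (i ∷_) (allVecs n k)) h)
      ≈⟨ Σ-cong (List.allFin n) (λ i → Σ-map (allVecs n k) _ h) ⟩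
    Σ' (List.allFin n) (λ i → Σ' (allVecs n k) (λ σ → h (i ∷ σ)))
      ≈⟨ Σ-δ (List.allFin n) _ (UniqueP.allFin⁺ n) (∈-allFin t₀) other-head ⟩
    Σ' (allVecs n k) (λ σ → h (t₀ ∷ σ))
      ≈⟨ Σ-allVecs-δ k (λ σ → h (t₀ ∷ σ)) t (λ σ σ≢t → h≈0 (t₀ ∷ σ) (λ eq → σ≢t (VecP.∷-injectiveʳ eq))) ⟩
    h (t₀ ∷ t) ∎
    where
    other-head : ∀ i → ¬ i ≡ t₀ → Σ' (allVecs n k) (λ σ → h (i ∷ σ)) ≈ 0#
    other-head i i≢t₀ = Σ-zero (allVecs n k) (λ σ → h≈0 (i ∷ σ) (λ eq → i≢t₀ (VecP.∷-injectiveˡ eq)))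

  -- only σ = τ contributes to the coefficient of the word of τ
  coefficient : ∀ τ → (∀ i → Edge π i (τ i)) →
                cayleyPerm K n π (word τ (List.allFin n)) ≈ ind (unique? (Vec.toList (Vec.tabulate τ)))
  coefficient τ edges = begin
    cayleyPerm K n π w                                      ≈⟨ ΣP-coeff (permutations n) _ w ⟩
    Σ' (permutations n) monomial                            ≈⟨ Σ-filter (λ σ → unique? (Vec.toList σ)) (allVecs n n) monomial ⟩
    Σ' (allVecs n n) (λ σ → ind (unique? (Vec.toList σ)) * monomial σ)
      ≈⟨ Σ-allVecs-δ n _ (Vec.tabulate τ) (λ σ σ≢τ → ≈-trans (*-congˡ (mismatch σ σ≢τ)) (zeroʳ _)) ⟩
    ind (unique? (Vec.toList (Vec.tabulate τ))) * monomial (Vec.tabulate τ)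
      ≈⟨ *-congˡ (monomial-match (Vec.tabulate τ) τ (List.allFin n) (All.tabulate (λ {i} _ → VecP.lookup∘tabulate τ i))
                                                      (All.tabulate (λ {i} _ → edges i))) ⟩
    ind (unique? (Vec.toList (Vec.tabulate τ))) * 1#        ≈⟨ *-identityʳ _ ⟩
    ind (unique? (Vec.toList (Vec.tabulate τ)))             ∎
    where
    w = word τ (List.allFin n)
    monomial : Vec (Fin n) n → Carrier
    monomial σ = ΠP (map (entry σ) (List.allFin n)) w
    mismatch : ∀ σ → ¬ σ ≡ Vec.tabulate τ → monomial σ ≈ 0#
    mismatch σ σ≢τ = monomial-mismatch σ τ (List.allFin n) (λ agree → σ≢τ
      (Eq.trans (Eq.sym (VecP.tabulate∘lookup σ)) (VecP.tabulate-cong (λ i → All.lookup agree (∈-allFin i)))))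

  coefficient-injective : ∀ τ → (∀ i → Edge π i (τ i)) → (∀ {a b} → τ a ≡ τ b → a ≡ b) →
                          cayleyPerm K n π (word τ (List.allFin n)) ≈ 1#
  coefficient-injective τ edges inj = ≈-trans (coefficient τ edges)
    (ind-yes (Eq.subst Unique (Eq.sym (toList-tabulate τ)) (UniqueP.tabulate⁺ inj)) (unique? _))

  coefficient-collision : ∀ τ → (∀ i → Edge π i (τ i)) → ∀ a b → τ a ≡ τ b → ¬ a ≡ b →
                          cayleyPerm K n π (word τ (List.allFin n)) ≈ 0#
  coefficient-collision τ edges a b τa≡τb a≢b = ≈-trans (coefficient τ edges)
    (ind-no (λ u → a≢b (unique-tabulate-injective τ (Eq.subst Unique (toList-tabulate τ) u) a b τa≡τb)) (unique? _))

-- The 2^|ks| subsets of a duplicate-free list ks, as characteristic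
-- functions supported on ks, any two of which differ at an element of ks.
module Subsets {A : Set} (_≟_ : DecidableEquality A) where

  update : A → Bool → (A → Bool) → A → Bool
  update j b D x = if does (x ≟ j) then b else D x

  update-here : ∀ j b D → update j b D j ≡ b
  update-here j b D with j ≟ j
  ... | yes _  = refl
  ... | no j≢j = ⊥-elim (j≢j refl)

  update-there : ∀ j b D x → ¬ x ≡ j → update j b D x ≡ D x
  update-there j b D x x≢j with x ≟ j
  ... | yes x≡j = ⊥-elim (x≢j x≡j)
  ... | no _    = refl

  subsets : List A → List (A → Bool)
  subsets []       = (λ _ → false) ∷ []
  subsets (j ∷ ks) = map (update j false) (subsets ks) ++ map (update j true) (subsets ks)

  length-subsets : ∀ ks → length (subsets ks) ≡ 2 ^ length ks
  length-subsets []       = refl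
  length-subsets (j ∷ ks) = begin
    length (map (update j false) (subsets ks) ++ map (update j true) (subsets ks))
      ≡⟨ ListP.length-++ (map (update j false) (subsets ks)) ⟩
    length (map (update j false) (subsets ks)) ℕ.+ length (map (update j true) (subsets ks))
      ≡⟨ Eq.cong₂ ℕ._+_ (halves false) (Eq.trans (halves true) (Eq.sym (ℕP.+-identityʳ _))) ⟩
    2 ^ length (j ∷ ks) ∎
    where
    open Eq.≡-Reasoning
    halves : ∀ b → length (map (update j b) (subsets ks)) ≡ 2 ^ length ks
    halves b = Eq.trans (ListP.length-map _ (subsets ks)) (length-subsets ks)

  Supported : List A → (A → Bool) → Set
  Supported ks D = ∀ x → D x ≡ true → x ∈ ks

  subsets-supported : ∀ ks → All (Supported ks) (subsets ks)
  subsets-supported []       = (λ _ ()) ∷ []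
  subsets-supported (j ∷ ks) =
    AllP.++⁺ (AllP.map⁺ (All.map (extend false) (subsets-supported ks)))
             (AllP.map⁺ (All.map (extend true) (subsets-supported ks)))
    where
    extend : ∀ b {D} → Supported ks D → Supported (j ∷ ks) (update j b D)
    extend b {D} supp x Dx with x ≟ j
    ... | yes x≡j = here x≡j
    ... | no _    = there (supp x Dx)

  DifferOn : List A → (A → Bool) → (A → Bool) → Set
  DifferOn ks D E = ∃ λ j → j ∈ ks × ¬ D j ≡ E j

  subsets-differ : ∀ ks → Unique ks → AllPairs (DifferOn ks) (subsets ks)
  subsets-differ []       _            = [] ∷ []
  subsets-differ (j ∷ ks) (j∉ks ∷ u) =
    AllPairsP.++⁺ (AllPairsP.map⁺ (AllPairs.map (extend false) rest))
                  (AllPairsP.map⁺ (AllPairs.map (extend true) rest))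
                  (AllP.map⁺ (All.tabulate (λ {D} _ → AllP.map⁺ (All.tabulate (λ {E} _ → j , here refl , differ-at-j D E)))))
    where
    rest = subsets-differ ks u
    agree : ∀ b D {x} → x ∈ ks → update j b D x ≡ D x
    agree b D x∈ks = update-there j b D _ (λ x≡j → All.lookup j∉ks x∈ks (Eq.sym x≡j))
    extend : ∀ b {D E} → DifferOn ks D E → DifferOn (j ∷ ks) (update j b D) (update j b E)
    extend b {D} {E} (x , x∈ks , Dx≢Ex) =
      x , there x∈ks , λ eq → Dx≢Ex (Eq.trans (Eq.sym (agree b D x∈ks)) (Eq.trans eq (agree b E x∈ks)))
    differ-at-j : ∀ D E → ¬ update j false D j ≡ update j true E j
    differ-at-j D E eq with Eq.trans (Eq.sym (update-here j false D)) (Eq.trans eq (update-here j true E))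
    ... | ()

take-allFin : ∀ n p → All (λ i → toℕ i < p) (List.take p (List.allFin n))
take-allFin n       zero    = []
take-allFin zero    (suc p) = []
take-allFin (suc n) (suc p)
  rewrite Eq.sym (ListP.map-tabulate {n = n} (λ i → i) Fin.suc) | ListP.take-map {f = Fin.suc} p (List.allFin n) =
  s≤s z≤n ∷ AllP.map⁺ (All.map s≤s (take-allFin n p))

drop-allFin : ∀ n p → All (λ i → p ≤ toℕ i) (List.drop p (List.allFin n))
drop-allFin n       zero    = All.tabulate (λ _ → z≤n)
drop-allFin zero    (suc p) = []
drop-allFin (suc n) (suc p)
  rewrite Eq.sym (ListP.map-tabulate {n = n} (λ i → i) Fin.suc) | ListP.drop-map {f = Fin.suc} p (List.allFin n) =
  AllP.map⁺ (All.map s≤s (drop-allFin n p))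

module Crossings (n : ℕ) (ι : FPFInvolution n) (p : ℕ) where
  open FPFInvolution ι
  open Subsets (_≟ᶠ_ {n})

  Crossing : Fin n → Set
  Crossing j = (toℕ j < p) × (p ≤ toℕ (π j))

  crossing? : Decidable Crossing
  crossing? j = (toℕ j ℕ.<? p) ×-dec (p ℕ.≤? toℕ (π j))

  crossings : List (Fin n)
  crossings = List.filter crossing? (List.allFin n)

  crossings-unique : Unique crossings
  crossings-unique = UniqueP.filter⁺ crossing? (UniqueP.allFin⁺ n)

  ∈-crossings : ∀ {j} → j ∈ crossings → Crossing j
  ∈-crossings j∈ = proj₂ (∈-filter⁻ crossing? {xs = List.allFin n} j∈)

  touched : (Fin n → Bool) → Fin n → Bool
  touched D i = D i ∨ D (π i)

  touched-π : ∀ D i → touched D (π i) ≡ touched D i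
  touched-π D i rewrite involut i = BoolP.∨-comm (D (π i)) (D i)

  swap : (Fin n → Bool) → Fin n → Fin n
  swap D i = if touched D i then π i else i

  swap-edge : ∀ D i → Edge π i (swap D i)
  swap-edge D i with touched D i
  ... | true  = inj₂ refl
  ... | false = inj₁ refl

  -- swap D is a permutation: π preserves `touched`, so a touched and an
  -- untouched vertex never have the same image
  swap-injective : ∀ D {a b} → swap D a ≡ swap D b → a ≡ b
  swap-injective D {a} {b} eq with touched D a in ta | touched D b in tb
  ... | true  | true  = Eq.trans (Eq.sym (involut a)) (Eq.trans (Eq.cong π eq) (involut b))
  ... | false | false = eq
  ... | true  | false with () ← Eq.trans (Eq.sym ta) (Eq.trans (Eq.sym (touched-π D a)) (Eq.trans (Eq.cong (touched D) eq) tb))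
  ... | false | true  with () ← Eq.trans (Eq.sym tb) (Eq.trans (Eq.sym (touched-π D b)) (Eq.trans (Eq.cong (touched D) (Eq.sym eq)) ta))

  glue : (Fin n → Bool) → (Fin n → Bool) → Fin n → Fin n
  glue D E i with toℕ i ℕ.<? p
  ... | yes _ = swap D i
  ... | no  _ = swap E i

  glue-before : ∀ D E i → toℕ i < p → glue D E i ≡ swap D i
  glue-before D E i i<p with toℕ i ℕ.<? p
  ... | yes _   = refl
  ... | no  i≮p = ⊥-elim (i≮p i<p)

  glue-after : ∀ D E i → p ≤ toℕ i → glue D E i ≡ swap E i
  glue-after D E i p≤i with toℕ i ℕ.<? p
  ... | yes i<p = ⊥-elim (ℕP.<⇒≱ i<p p≤i)
  ... | no  _   = refl

  glue-diagonal : ∀ D i → glue D D i ≡ swap D i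
  glue-diagonal D i with toℕ i ℕ.<? p
  ... | yes _ = refl
  ... | no  _ = refl

  glue-edge : ∀ D E i → Edge π i (glue D E i)
  glue-edge D E i with toℕ i ℕ.<? p
  ... | yes _ = swap-edge D i
  ... | no  _ = swap-edge E i

  glue-diagonal-injective : ∀ D {a b} → glue D D a ≡ glue D D b → a ≡ b
  glue-diagonal-injective D {a} {b} eq =
    swap-injective D (Eq.trans (Eq.sym (glue-diagonal D a)) (Eq.trans eq (glue-diagonal D b)))

  -- the partner π j ≥ p of a crossing j does not cross, so is never in D
  partner-absent : ∀ {D j} → Supported crossings D → j ∈ crossings → D (π j) ≡ false
  partner-absent {D} {j} supp j∈ with D (π j) in Dπj
  ... | false = refl
  ... | true  = ⊥-elim (ℕP.<⇒≱ (proj₁ (∈-crossings (supp (π j) Dπj))) (proj₂ (∈-crossings j∈)))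

  swap-crossing : ∀ {D j} → Supported crossings D → j ∈ crossings → swap D j ≡ (if D j then π j else j)
  swap-crossing {D} {j} supp j∈ rewrite partner-absent supp j∈ | BoolP.∨-identityʳ (D j) = refl

  swap-partner : ∀ {D j} → Supported crossings D → j ∈ crossings → swap D (π j) ≡ (if D j then j else π j)
  swap-partner {D} {j} supp j∈ rewrite involut j | partner-absent supp j∈ = refl

  glue-collision : ∀ {D E j} → Supported crossings D → Supported crossings E → j ∈ crossings →
                   ¬ D j ≡ E j → glue D E j ≡ glue D E (π j)
  glue-collision {D} {E} {j} suppD suppE j∈ Dj≢Ej
    rewrite glue-before D E j (proj₁ (∈-crossings j∈)) | glue-after D E (π j) (proj₂ (∈-crossings j∈))
          | swap-crossing suppD j∈ | swap-partner suppE j∈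
    with D j | E j
  ... | true  | true  = ⊥-elim (Dj≢Ej refl)
  ... | false | false = ⊥-elim (Dj≢Ej refl)
  ... | true  | false = refl
  ... | false | true  = refl

  prefix suffix : List (Fin n)
  prefix = List.take p (List.allFin n)
  suffix = List.drop p (List.allFin n)

  word-glue : ∀ D E → word (swap D) prefix ++ word (swap E) suffix ≡ word (glue D E) (List.allFin n)
  word-glue D E = begin
    word (swap D) prefix ++ word (swap E) suffix
      ≡⟨ Eq.cong₂ _++_ (ListP.map-cong-local (All.map (λ i<p → Eq.cong (_ ,_) (Eq.sym (glue-before D E _ i<p))) (take-allFin n p)))
                        (ListP.map-cong-local (All.map (λ p≤i → Eq.cong (_ ,_) (Eq.sym (glue-after D E _ p≤i))) (drop-allFin n p))) ⟩
    word (glue D E) prefix ++ word (glue D E) suffix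
      ≡⟨ Eq.sym (ListP.map-++ _ prefix suffix) ⟩
    word (glue D E) (prefix ++ suffix)
      ≡⟨ Eq.cong (word (glue D E)) (ListP.take++drop≡id p (List.allFin n)) ⟩
    word (glue D E) (List.allFin n) ∎
    where open Eq.≡-Reasoning

module PositionBound {c ℓ} (K : Field c ℓ) (n : ℕ) (ι : FPFInvolution n) (A : NCPoly.ABP K (_≟V_ {n}))
                     (computes : NCPoly.Computes K _≟V_ A (cayleyPerm K n (FPFInvolution.π ι))) (p : ℕ) where
  open FPFInvolution ι
  open Field K renaming (refl to ≈-refl; sym to ≈-sym; trans to ≈-trans)
  open NCPoly K (_≟V_ {n})
  open ListSums commutativeRing
  open RankBound K
  open Factorisation K (_≟V_ {n}) A
  open PermanentCoefficients K n π
  open Crossings n ι p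
  open Subsets (_≟ᶠ_ {n})

  L : (Fin n → Bool) → State → Carrier
  L D = before (ABP.size A) (ABP.s A) (word (swap D) prefix)

  R : State → (Fin n → Bool) → Carrier
  R st E = after st (word (swap E) suffix)

  product-coefficient : ∀ D E → Product states L R D E ≈ cayleyPerm K n π (word (glue D E) (List.allFin n))
  product-coefficient D E = ≈-trans (≈-sym (output-factor (word (swap D) prefix) (word (swap E) suffix)))
    (≈-trans (computes _) (reflexive (Eq.cong (cayleyPerm K n π) (word-glue D E))))

  identity : IdentityOn (DifferOn crossings) (subsets crossings) states L R
  identity = record
    { diagonal    = λ {D} _ → ≈-trans (product-coefficient D D)
                       (coefficient-injective (glue D D) (glue-edge D D) (glue-diagonal-injective D))
    ; offDiagonal = λ {D} {E} D∈ E∈ (j , j∈ , Dj≢Ej) →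
          ≈-trans (product-coefficient D E)
            (collide D E (supported D∈) (supported E∈) j∈ Dj≢Ej)
        , ≈-trans (product-coefficient E D)
            (collide E D (supported E∈) (supported D∈) j∈ (λ eq → Dj≢Ej (Eq.sym eq)))
    }
    where
    supported : ∀ {D} → D ∈ subsets crossings → Supported crossings D
    supported D∈ = All.lookup (subsets-supported crossings) D∈
    collide : ∀ D E → Supported crossings D → Supported crossings E → ∀ {j} → j ∈ crossings → ¬ D j ≡ E j →
              cayleyPerm K n π (word (glue D E) (List.allFin n)) ≈ 0#
    collide D E suppD suppE {j} j∈ Dj≢Ej = coefficient-collision (glue D E) (glue-edge D E) j (π j)
      (glue-collision suppD suppE j∈ Dj≢Ej) (λ j≡πj → fpFree j (Eq.sym j≡πj))

  crossing-bound : 2 ^ length crossings ≤ ABP.size A ℕ.* suc (ABP.size A)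
  crossing-bound = Eq.subst₂ _≤_ (length-subsets crossings) length-states
    (rank-bound (subsets crossings) states L R (subsets-differ crossings crossings-unique) identity)

max-attained : ∀ {A : Set} (f : A → ℕ) (xs : List A) → 0 < foldr ℕ._⊔_ 0 (map f xs) →
               ∃ λ x → foldr ℕ._⊔_ 0 (map f xs) ≤ f x
max-attained f (x ∷ xs) pos with ℕP.⊔-sel (f x) (foldr ℕ._⊔_ 0 (map f xs))
... | inj₁ eq = x , ℕP.≤-reflexive eq
... | inj₂ eq rewrite eq = max-attained f xs pos

length-filter-∷ : ∀ {A : Set} {Q : A → Set} (Q? : Decidable Q) x (xs : List A) →
                  length (List.filter Q? xs) ≤ length (List.filter Q? (x ∷ xs))
length-filter-∷ Q? x xs with Q? x
... | yes _ = ℕP.n≤1+n _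
... | no  _ = ℕP.≤-refl

length-filter-cover : ∀ {A : Set} {P Q₁ Q₂ : A → Set} (P? : Decidable P) (Q₁? : Decidable Q₁) (Q₂? : Decidable Q₂)
                      (xs : List A) → (∀ x → P x → Q₁ x ⊎ Q₂ x) →
                      length (List.filter P? xs) ≤ length (List.filter Q₁? xs) ℕ.+ length (List.filter Q₂? xs)
length-filter-cover P? Q₁? Q₂? []       cover = z≤n
length-filter-cover P? Q₁? Q₂? (x ∷ xs) cover with P? x
... | no _ = ℕP.≤-trans ih (ℕP.+-mono-≤ (length-filter-∷ Q₁? x xs) (length-filter-∷ Q₂? x xs))
  where ih = length-filter-cover P? Q₁? Q₂? xs cover
... | yes px with Q₁? x | Q₂? x
...   | yes _ | yes _ = s≤s (ℕP.≤-trans ih (ℕP.+-monoʳ-≤ (length (List.filter Q₁? xs)) (ℕP.n≤1+n _)))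
  where ih = length-filter-cover P? Q₁? Q₂? xs cover
...   | yes _ | no  _ = s≤s (length-filter-cover P? Q₁? Q₂? xs cover)
...   | no  _ | yes _ = Eq.subst (suc (length (List.filter P? xs)) ≤_)
                          (Eq.sym (ℕP.+-suc (length (List.filter Q₁? xs)) (length (List.filter Q₂? xs))))
                          (s≤s (length-filter-cover P? Q₁? Q₂? xs cover))
...   | no ¬q₁ | no ¬q₂ with cover x px
...     | inj₁ q₁ = ⊥-elim (¬q₁ q₁)
...     | inj₂ q₂ = ⊥-elim (¬q₂ q₂)

-- every transposition of C_k(π) crosses position k or position k+1:
-- j < k gives j < k ≤ π j, and j = k gives j < k+1 ≤ π j
C-covered : ∀ n (ι : FPFInvolution n) k →
            Ccard (FPFInvolution.π ι) k ≤
              length (Crossings.crossings n ι (suc (toℕ k))) ℕ.+ length (Crossings.crossings n ι (toℕ k))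
C-covered n ι k = length-filter-cover _ (Crossings.crossing? n ι (suc (toℕ k))) (Crossings.crossing? n ι (toℕ k))
                                      (List.allFin n) cover
  where
  open FPFInvolution ι
  cover : ∀ j → (toℕ j < toℕ (π j)) × ((toℕ j ≤ toℕ k) × (toℕ k ≤ toℕ (π j))) →
          Crossings.Crossing n ι (suc (toℕ k)) j ⊎ Crossings.Crossing n ι (toℕ k) j
  cover j (j<πj , j≤k , k≤πj) with toℕ j ℕ.<? toℕ k
  ... | yes j<k = inj₂ (j<k , k≤πj)
  ... | no  j≮k = inj₁ (s≤s j≤k , ℕP.≤-<-trans (ℕP.≮⇒≥ j≮k) j<πj)

-- (S·(S+1))² ≤ S⁶ once S ≥ 2, and S ≥ 2 is forced by 2^c ≤ (S·(S+1))² with c ≥ 3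
square-bound : ∀ S c → 3 ≤ c → 2 ^ c ≤ (S ℕ.* suc S) ℕ.* (S ℕ.* suc S) → 2 ^ c ≤ S ^ 6
square-bound zero c _ bound with ℕP.≤-trans (ℕP.^-monoʳ-≤ 2 (z≤n {c})) bound
... | ()
square-bound (suc zero) c 3≤c bound with ℕP.≤-trans (ℕP.^-monoʳ-≤ 2 3≤c) bound
... | s≤s (s≤s (s≤s (s≤s ())))
square-bound (suc (suc s)) c _ bound = ℕP.≤-trans bound (ℕP.≤-trans (ℕP.*-mono-≤ factor≤ factor≤) (ℕP.≤-reflexive (Eq.sym S⁶)))
  where
  S = suc (suc s)
  factor≤ : S ℕ.* suc S ≤ S ℕ.* (S ℕ.* S)
  factor≤ = ℕP.*-monoʳ-≤ S (Eq.subst (_≤ S ℕ.* S) (ℕP.+-comm S 1) (ℕP.+-monoʳ-≤ S (s≤s z≤n)))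
  S³ : S ^ 3 ≡ S ℕ.* (S ℕ.* S)
  S³ = Eq.cong (λ t → S ℕ.* (S ℕ.* t)) (ℕP.*-identityʳ S)
  S⁶ : S ^ 6 ≡ (S ℕ.* (S ℕ.* S)) ℕ.* (S ℕ.* (S ℕ.* S))
  S⁶ = Eq.trans (ℕP.^-distribˡ-+-* S 3 3) (Eq.cong₂ ℕ._*_ S³ S³)

theorem3 : ∃₂ω (λ a k₀ → ∀ {c ℓ} (K : Field c ℓ) (n : ℕ) → 2 ∣ n → (ι : FPFInvolution n) → (A : NCPoly.ABP K (_≟V_ {n})) → NCPoly.Computes K _≟V_ A (cayleyPerm K n (FPFInvolution.π ι)) → k₀ ≤ cut (FPFInvolution.π ι) → 2 ^ cut (FPFInvolution.π ι) ≤ abpSize A ^ a)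
theorem3 = record { a = 6 ; k₀ = 3 ; prop = bound }
  where
  bound : ∀ {c ℓ} (K : Field c ℓ) (n : ℕ) → 2 ∣ n → (ι : FPFInvolution n) → (A : NCPoly.ABP K (_≟V_ {n})) →
          NCPoly.Computes K _≟V_ A (cayleyPerm K n (FPFInvolution.π ι)) →
          3 ≤ cut (FPFInvolution.π ι) → 2 ^ cut (FPFInvolution.π ι) ≤ abpSize A ^ 6
  bound K n _ ι A computes 3≤cut with max-attained (Ccard (FPFInvolution.π ι)) (List.allFin n) (ℕP.<-≤-trans (s≤s z≤n) 3≤cut)
  ... | k , cut≤Ck = square-bound (ABP.size A) _ 3≤cut (begin
    2 ^ cut π                         ≤⟨ ℕP.^-monoʳ-≤ 2 (ℕP.≤-trans cut≤Ck (C-covered n ι k)) ⟩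
    2 ^ (m (suc (toℕ k)) ℕ.+ m (toℕ k)) ≡⟨ ℕP.^-distribˡ-+-* 2 (m (suc (toℕ k))) (m (toℕ k)) ⟩
    2 ^ m (suc (toℕ k)) ℕ.* 2 ^ m (toℕ k) ≤⟨ ℕP.*-mono-≤ (crossing-bound (suc (toℕ k))) (crossing-bound (toℕ k)) ⟩
    (ABP.size A ℕ.* suc (ABP.size A)) ℕ.* (ABP.size A ℕ.* suc (ABP.size A)) ∎)
    where
    open ℕP.≤-Reasoning
    open FPFInvolution ι using (π)
    open NCPoly K (_≟V_ {n}) using (ABP)
    m : ℕ → ℕ
    m p = length (Crossings.crossings n ι p)
    crossing-bound : ∀ p → 2 ^ m p ≤ ABP.size A ℕ.* suc (ABP.size A)
    crossing-bound = PositionBound.crossing-bound K n ι A computes
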